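{- Let $R=(Z,A(R))$ be a finite digraph. Let $X,M\subseteq Z$ be disjoint, and let $Y\subseteq Z$ with $M\cap Y=\emptyset$ and $M\cap N_R(y)=\emptyset$ for all $y\in Y$. Let $\beta:X\to Y$ be a bijective map that is a homomorphism from $R|_X$ to $R|_Y$. Assume that for all $x\in X$, $$N^{in}_R(x)\setminus M\subseteq N^{in}_R(\beta(x))\quad\text{and}\quad N^{out}_R(x)\setminus M\subseteq N^{out}_R(\beta(x)).$$ Let $\psi:\mathcal{E}_o(R)\to Z$ and $\epsilon$ be as in the context. Then: - if for every $x\in X$ one has $N_R(x)\cap M=\emptyset$ or $N_R(x)\setminus M=\emptyset$, then $\epsilon$ is one-to-one; - if $X\cap Y=\emptyset$, the converse holds as well: if $\epsilon$ is one-to-one, then for every $x\in X$, $N_R(x)\cap M=\emptyset$ or $N_R(x)\setminus M=\emptyset$.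
   Context: Digraphs have a finite nonempty vertex set and arc set $A\subseteq V\times V$; loops are allowed, and $vw$ denotes $(v,w)$. For $v\in V(G)$: - $N_G(v)$ is the set of $w\neq v$ with $vw\in A(G)$ or $wv\in A(G)$; - $N^{in}_G(v)=\{w\in N_G(v):wv\in A(G)\}$ and $N^{out}_G(v)=\{w\in N_G(v):vw\in A(G)\}$. $R|_X$ denotes the subdigraph induced on $X$. A strict homomorphism maps arcs to arcs and proper arcs to proper arcs. $\mathfrak{D}$ denotes a representative system of the isomorphism classes of finite digraphs. EV-system $\mathcal{E}(R)$ of $R$ with respect to $\mathfrak{D}$: - Vertex set $\mathcal{E}_o(R)=\{(v,D,U):v\in Z,\ D\subseteq N^{in}_R(v),\ U\subseteq N^{out}_R(v)\}$, with components $\mathfrak{a}_1,\mathfrak{a}_2,\mathfrak{a}_3$. - $\mathfrak{a}\mathfrak{b}$ is an arc iff there exist a finite digraph $G$, a strict homomorphism $\xi:G\to R$ and $vw\in A(G)$ with $\mathfrak{a}=(\xi(v),\xi[N^{in}_G(v)],\xi[N^{out}_G(v)])$ and $\mathfrak{b}=(\xi(w),\xi[N^{in}_G(w)],\xi[N^{out}_G(w)])$. - $\phi_R(\mathfrak{a})=\mathfrak{a}_1$. The map $\psi=\rho_{\mathcal{E}(R)}(\phi_R)$ is defined by: - $\psi(\mathfrak{a})=\beta(\mathfrak{a}_1)$ if $\mathfrak{a}_1\in X$ and $\phi_R[N_{\mathcal{E}(R)}(\mathfrak{a})]\cap M\ne\emptyset$; - $\psi(\mathfrak{a})=\mathfrak{a}_1$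 otherwise. This is the rearrangement S-scheme $\rho$ applied to $\phi_R$; the rearranged digraph $S$ has vertex set $Z$. Finally, $$\epsilon(\mathfrak{a})=\big(\psi(\mathfrak{a}),\ \psi[N^{in}_{\mathcal{E}(R)}(\mathfrak{a})],\ \psi[N^{out}_{\mathcal{E}(R)}(\mathfrak{a})]\big).$$ -}

module Defs where

open import Data.Nat using (ℕ)
open import Data.Bool using (Bool; true)
open import Data.Fin using (Fin)
open import Data.Fin.Subset using (Subset; _∈_; _∉_)
open import Data.Product using (Σ; ∃; _×_)
open import Data.Sum using (_⊎_)
open import Relation.Nullary using (¬_)
open import Relation.Binary.PropositionalEquality using (_≡_; _≢_)
open import Function.Bundles using (_⇔_)

-- A finite digraph on vertex set Fin n (loops allowed): arc relation as a Bool matrix.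
Digraph : ℕ → Set
Digraph n = Fin n → Fin n → Bool

Arc : ∀ {n} → Digraph n → Fin n → Fin n → Set
Arc G v w = G v w ≡ true

Nin : ∀ {n} → Digraph n → Fin n → Fin n → Set
Nin G v w = w ≢ v × Arc G w v

Nout : ∀ {n} → Digraph n → Fin n → Fin n → Set
Nout G v w = w ≢ v × Arc G v w

Nb : ∀ {n} → Digraph n → Fin n → Fin n → Set
Nb G v w = w ≢ v × (Arc G v w ⊎ Arc G w v)

StrictHom : ∀ {m n} → Digraph m → Digraph n → (Fin m → Fin n) → Set
StrictHom G R ξ = ∀ v w → Arc G v w → Arc R (ξ v) (ξ w) × (v ≢ w → ξ v ≢ ξ w)

Image : ∀ {m n} → (Fin m → Fin n) → (Fin m → Set) → Fin n → Set
Image ξ P z = ∃ λ u → P u × ξ u ≡ z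

SameSet : ∀ {n} → Subset n → (Fin n → Set) → Set
SameSet {n} S P = (z : Fin n) → (z ∈ S) ⇔ P z

-- vertices of the EV-system: (v , D , U) with D ⊆ N^in_R(v), U ⊆ N^out_R(v)
record EV {n : ℕ} (R : Digraph n) : Set where
  constructor ev
  field
    a₁  : Fin n
    a₂  : Subset n
    a₃  : Subset n
    a₂⊆ : ∀ w → w ∈ a₂ → Nin R a₁ w
    a₃⊆ : ∀ w → w ∈ a₃ → Nout R a₁ w
open EV public

_≈E_ : ∀ {n} {R : Digraph n} → EV R → EV R → Set
a ≈E b = a₁ a ≡ a₁ b × a₂ a ≡ a₂ b × a₃ a ≡ a₃ b

Represents : ∀ {m n} {R : Digraph n} → Digraph m → (Fin m → Fin n) → Fin m → EV R → Set
Represents G ξ v a =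
  ξ v ≡ a₁ a × SameSet (a₂ a) (Image ξ (Nin G v)) × SameSet (a₃ a) (Image ξ (Nout G v))

EArc : ∀ {n : ℕ} (R : Digraph n) → EV R → EV R → Set
EArc {n} R a b =
  Σ ℕ λ m → Σ (Digraph m) λ G → Σ (Fin m → Fin n) λ ξ →
    StrictHom G R ξ × Σ (Fin m) λ v → Σ (Fin m) λ w →
      Arc G v w × Represents G ξ v a × Represents G ξ w b

NinE : ∀ {n} (R : Digraph n) → EV R → EV R → Set
NinE R a c = ¬ (c ≈E a) × EArc R c a

NoutE : ∀ {n} (R : Digraph n) → EV R → EV R → Set
NoutE R a c = ¬ (c ≈E a) × EArc R a c

NbE : ∀ {n} (R : Digraph n) → EV R → EV R → Set
NbE R a c = ¬ (c ≈E a) × (EArc R a c ⊎ EArc R c a)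

PsiCond : ∀ {n} (R : Digraph n) (X M : Subset n) → EV R → Set
PsiCond R X M a = a₁ a ∈ X × ∃ λ c → NbE R a c × a₁ c ∈ M

-- graph of ψ = ρ_{E(R)}(φ_R):  ψ(a) = z
Psi : ∀ {n} (R : Digraph n) (X M : Subset n) (β : Fin n → Fin n) → EV R → Fin n → Set
Psi R X M β a z =
  (PsiCond R X M a × z ≡ β (a₁ a)) ⊎ (¬ PsiCond R X M a × z ≡ a₁ a)

PsiImgIn : ∀ {n} (R : Digraph n) (X M : Subset n) (β : Fin n → Fin n) → EV R → Fin n → Set
PsiImgIn R X M β a z = ∃ λ c → NinE R a c × Psi R X M β c z

PsiImgOut : ∀ {n} (R : Digraph n) (X M : Subset n) (β : Fin n → Fin n) → EV R → Fin n → Set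
PsiImgOut R X M β a z = ∃ λ c → NoutE R a c × Psi R X M β c z

EpsEq : ∀ {n} (R : Digraph n) (X M : Subset n) (β : Fin n → Fin n) → EV R → EV R → Set
EpsEq {n} R X M β a b =
  ((z : Fin n) → Psi R X M β a z ⇔ Psi R X M β b z) ×
  ((z : Fin n) → PsiImgIn R X M β a z ⇔ PsiImgIn R X M β b z) ×
  ((z : Fin n) → PsiImgOut R X M β a z ⇔ PsiImgOut R X M β b z)

EpsInjective : ∀ {n} (R : Digraph n) (X M : Subset n) (β : Fin n → Fin n) → Set
EpsInjective R X M β = ∀ a b → EpsEq R X M β a b → a ≈E b

NbCondition : ∀ {n} (R : Digraph n) (X M : Subset n) → Set
NbCondition {n} R X M = (x : Fin n) → x ∈ X →
  ((w : Fin n) → Nb R x w → w ∉ M) ⊎ ((w : Fin n) → Nb R x w → w ∈ M)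

Disjoint : ∀ {n} → Subset n → Subset n → Set
Disjoint {n} S T = (z : Fin n) → z ∈ S → z ∉ T

-- β : X → Y bijective (β given as a total map, only its values on X matter)
BijectiveOn : ∀ {n} → (Fin n → Fin n) → Subset n → Subset n → Set
BijectiveOn {n} β X Y =
  ((x : Fin n) → x ∈ X → β x ∈ Y) ×
  ((x x′ : Fin n) → x ∈ X → x′ ∈ X → β x ≡ β x′ → x ≡ x′) ×
  ((y : Fin n) → y ∈ Y → ∃ λ x → x ∈ X × β x ≡ y)

HomOn : ∀ {n} → Digraph n → (Fin n → Fin n) → Subset n → Set
HomOn {n} R β X = (x x′ : Fin n) → x ∈ X → x′ ∈ X → Arc R x x′ → Arc R (β x) (β x′)

-- A proper arc c → a of E(R) exists exactly when a₁ c ∈ a₂ a and a₁ a ∈ a₃ c: any realising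
-- digraph shows this through the images of the neighbourhoods, and two glued stars realise it.
-- Consequently ψ(a) = β(a₁ a) iff a₁ a ∈ X and a₂ a ∪ a₃ a meets M, and the in/out components
-- of ε(a) are the ψ-values of the neighbours of a, whose labels range over a₂ a, resp. a₃ a.
-- Sufficiency: if labels d, d′ adjacent to a common vertex v of R have equal ψ-values, then
-- d = d′; a mixed coincidence d′ = β d forces v ∉ M (v is adjacent to d′ ∈ Y) while d ∈ X also
-- has a neighbour in M. Testing ε(a) = ε(b) on the leaves (d, ∅, {a₁ a}) thus recovers a₂, a₃.
-- Necessity: if x ∈ X has neighbours w₁ ∈ M and w₂ ∉ M, then (w₂, {x}) and (w₂, {x, β x}) have
-- the same ε-value, because ψ sends vertices labelled x to both x and β x.

module Submission where

open import Defs
open import Data.Nat using (ℕ; _*_)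
open import Data.Bool using (true)
import Data.Bool.Properties as Bool
open import Data.Fin using (Fin; zero; suc; combine; remQuot; _≟_)
open import Data.Fin.Properties using (remQuot-combine; any?)
open import Data.Fin.Subset using (Subset; _∈_; _∉_; _⊆_; _∪_; ⁅_⁆) renaming (⊥ to ∅)
open import Data.Fin.Subset.Properties
  using (_∈?_; ∉⊥; x∈⁅x⁆; x∈⁅y⁆⇒x≡y; x∈p∪q⁺; x∈p∪q⁻; ⊆-antisym)
open import Data.List using (List; []; _∷_)
open import Data.List.Relation.Unary.Any using (here; there)
open import Data.Product using (Σ; ∃; _×_; _,_; proj₁; proj₂; swap)
open import Data.Product.Properties using (≡-dec)
open import Data.Sum using (_⊎_; inj₁; inj₂)
open import Data.Empty using (⊥; ⊥-elim)
open import Relation.Nullary using (¬_; Dec; yes; no; ¬?)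
open import Relation.Nullary.Decidable
  using (_×-dec_; _⊎-dec_; map; isYes; toWitness; fromWitness; decidable-stable)
open import Relation.Binary.PropositionalEquality
  using (_≡_; _≢_; refl; sym; trans; cong; subst; subst₂; ≢-sym)
open import Function.Bundles using (_⇔_; mk⇔; Equivalence)
open Equivalence using (to; from)
import Function.Properties.Equivalence as ⇔

data Side : Set where
  inward outward : Side

opposite : Side → Side
opposite inward  = outward
opposite outward = inward

module _ {n : ℕ} where

  NbOn : Side → Digraph n → Fin n → Fin n → Set
  NbOn inward  = Nin
  NbOn outward = Nout

  module _ {R : Digraph n} {v w : Fin n} where

    NbOn⇒Nb : ∀ s → NbOn s R v w → Nb R v w
    NbOn⇒Nb inward  (w≢v , wv) = w≢v , inj₂ wv
    NbOn⇒Nb outward (w≢v , vw) = w≢v , inj₁ vw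

    Nb⇒NbOn : Nb R v w → Σ Side λ s → NbOn s R v w
    Nb⇒NbOn (w≢v , inj₁ vw) = outward , w≢v , vw
    Nb⇒NbOn (w≢v , inj₂ wv) = inward , w≢v , wv

    NbOn-opposite : ∀ s → NbOn s R v w → NbOn (opposite s) R w v
    NbOn-opposite inward  (w≢v , wv) = ≢-sym w≢v , wv
    NbOn-opposite outward (w≢v , vw) = ≢-sym w≢v , vw

  Nb-sym : ∀ {R : Digraph n} {v w} → Nb R v w → Nb R w v
  Nb-sym (w≢v , inj₁ vw) = ≢-sym w≢v , inj₂ vw
  Nb-sym (w≢v , inj₂ wv) = ≢-sym w≢v , inj₁ wv

  Admissible : Side → Digraph n → Fin n → Subset n → Set
  Admissible s R v S = ∀ {w} → w ∈ S → NbOn s R v w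

  only : Side → Subset n → Side → Subset n
  only inward  S inward  = S
  only outward S outward = S
  only _       _ _       = ∅

  only⁻ : ∀ s t {S w} → w ∈ only s S t → t ≡ s × w ∈ S
  only⁻ inward  inward  w∈ = refl , w∈
  only⁻ outward outward w∈ = refl , w∈
  only⁻ inward  outward w∈ = ⊥-elim (∉⊥ w∈)
  only⁻ outward inward  w∈ = ⊥-elim (∉⊥ w∈)

  Nb? : (R : Digraph n) (v w : Fin n) → Dec (Nb R v w)
  Nb? R v w = ¬? (w ≟ v) ×-dec ((R v w Bool.≟ true) ⊎-dec (R w v Bool.≟ true))

-- A vertex (t , k) of the realising digraph has type t and is mapped to k; only vertices whose
-- label fits their type (Label t k) carry arcs, so ξ maps neighbourhoods onto a₂, a₃ of a and c.
module Realisation {n : ℕ} (R : Digraph n) (c a : EV R)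
  (c∈ : a₁ c ∈ a₂ a) (a∈ : a₁ a ∈ a₃ c) where

  pattern P     = zero
  pattern Q     = suc zero
  pattern Q-in  = suc (suc zero)
  pattern Q-out = suc (suc (suc zero))
  pattern P-in  = suc (suc (suc (suc zero)))
  pattern P-out = suc (suc (suc (suc (suc zero))))

  Vertex : Set
  Vertex = Fin 6 × Fin n

  Label : Fin 6 → Fin n → Set
  Label P     k = k ≡ a₁ c
  Label Q     k = k ≡ a₁ a
  Label Q-in  k = k ∈ a₂ a
  Label Q-out k = k ∈ a₃ a
  Label P-in  k = k ∈ a₂ c
  Label P-out k = k ∈ a₃ c

  label? : ∀ t k → Dec (Label t k)
  label? P     k = k ≟ a₁ c
  label? Q     k = k ≟ a₁ a
  label? Q-in  k = k ∈? a₂ a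
  label? Q-out k = k ∈? a₃ a
  label? P-in  k = k ∈? a₂ c
  label? P-out k = k ∈? a₃ c

  open import Data.List.Membership.DecPropositional (≡-dec (_≟_ {6}) (_≟_ {6}))
    using () renaming (_∈_ to _∈ₗ_; _∈?_ to _∈ₗ?_)

  typeArcs : List (Fin 6 × Fin 6)
  typeArcs = (P , Q) ∷ (Q-in , Q) ∷ (Q , Q-out) ∷ (P-in , P) ∷ (P , P-out) ∷ []

  Edge : Vertex → Vertex → Set
  Edge (s , k) (t , k′) = (s , t) ∈ₗ typeArcs × Label s k × Label t k′

  edge? : ∀ u v → Dec (Edge u v)
  edge? (s , k) (t , k′) = ((s , t) ∈ₗ? typeArcs) ×-dec label? s k ×-dec label? t k′

  Nin⇒arc : ∀ {v w} → Nin R v w → Arc R w v × w ≢ v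
  Nin⇒arc = swap

  Nout⇒arc : ∀ {v w} → Nout R v w → Arc R v w × v ≢ w
  Nout⇒arc (w≢v , vw) = vw , ≢-sym w≢v

  edge-sound : ∀ {u v} → Edge u v → Arc R (proj₂ u) (proj₂ v) × proj₂ u ≢ proj₂ v
  edge-sound (here refl , refl , refl) = Nout⇒arc (a₃⊆ c _ a∈)
  edge-sound (there (here refl) , k∈ , refl) = Nin⇒arc (a₂⊆ a _ k∈)
  edge-sound (there (there (here refl)) , refl , k∈) = Nout⇒arc (a₃⊆ a _ k∈)
  edge-sound (there (there (there (here refl))) , k∈ , refl) = Nin⇒arc (a₂⊆ c _ k∈)
  edge-sound (there (there (there (there (here refl)))) , refl , k∈) = Nout⇒arc (a₃⊆ c _ k∈)
  edge-sound (there (there (there (there (there ())))) , _)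

  enc : Vertex → Fin (6 * n)
  enc (t , k) = combine t k

  dec : Fin (6 * n) → Vertex
  dec = remQuot n

  dec-enc : ∀ u → dec (enc u) ≡ u
  dec-enc (t , k) = remQuot-combine t k

  G : Digraph (6 * n)
  G i j = isYes (edge? (dec i) (dec j))

  ξ : Fin (6 * n) → Fin n
  ξ i = proj₂ (dec i)

  arc⇒edge : ∀ {i j} → Arc G i j → Edge (dec i) (dec j)
  arc⇒edge ij = toWitness (from Bool.T-≡ ij)

  edge⇒arc : ∀ {u v} → Edge u v → Arc G (enc u) (enc v)
  edge⇒arc {u} {v} uv = to Bool.T-≡ (fromWitness (subst₂ Edge (sym (dec-enc u)) (sym (dec-enc v)) uv))

  ξ-enc : ∀ u → ξ (enc u) ≡ proj₂ u
  ξ-enc u = cong proj₂ (dec-enc u)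

  enc-≢ : ∀ u v → proj₂ u ≢ proj₂ v → enc u ≢ enc v
  enc-≢ u v k≢k′ e = k≢k′ (trans (sym (ξ-enc u)) (trans (cong ξ e) (ξ-enc v)))

  ξ-strictHom : StrictHom G R ξ
  ξ-strictHom i j ij = proj₁ (edge-sound (arc⇒edge ij)) , λ _ → proj₂ (edge-sound (arc⇒edge ij))

  in-image : ∀ {S} y → (∀ {k} → k ∈ S → ∃ λ s → Edge (s , k) y) →
             (∀ {u} → Edge u y → proj₂ u ∈ S) → SameSet S (Image ξ (Nin G (enc y)))
  in-image {S} y realise sound z = mk⇔ into outof
    where
    into : z ∈ S → Image ξ (Nin G (enc y)) z
    into z∈ with realise z∈
    ... | s , e = enc (s , z) , (enc-≢ (s , z) y (proj₂ (edge-sound e)) , edge⇒arc e) , ξ-enc (s , z)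
    outof : Image ξ (Nin G (enc y)) z → z ∈ S
    outof (i , (_ , arc) , ξi≡z) =
      subst (_∈ S) ξi≡z (sound (subst (Edge (dec i)) (dec-enc y) (arc⇒edge arc)))

  out-image : ∀ {S} y → (∀ {k} → k ∈ S → ∃ λ t → Edge y (t , k)) →
              (∀ {u} → Edge y u → proj₂ u ∈ S) → SameSet S (Image ξ (Nout G (enc y)))
  out-image {S} y realise sound z = mk⇔ into outof
    where
    into : z ∈ S → Image ξ (Nout G (enc y)) z
    into z∈ with realise z∈
    ... | t , e = enc (t , z) , (enc-≢ (t , z) y (≢-sym (proj₂ (edge-sound e))) , edge⇒arc e) , ξ-enc (t , z)
    outof : Image ξ (Nout G (enc y)) z → z ∈ S
    outof (i , (_ , arc) , ξi≡z) =
      subst (_∈ S) ξi≡z (sound (subst (λ y′ → Edge y′ (dec i)) (dec-enc y) (arc⇒edge arc)))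

  into-Q : ∀ {u} → Edge u (Q , a₁ a) → proj₂ u ∈ a₂ a
  into-Q {P , _} (here refl , refl , _) = c∈
  into-Q {Q-in , _} (there (here refl) , k∈ , _) = k∈
  into-Q (there (there (here ())) , _)
  into-Q (there (there (there (here ()))) , _)
  into-Q (there (there (there (there (here ())))) , _)
  into-Q (there (there (there (there (there ())))) , _)

  out-of-Q : ∀ {u} → Edge (Q , a₁ a) u → proj₂ u ∈ a₃ a
  out-of-Q (here () , _)
  out-of-Q (there (here ()) , _)
  out-of-Q {Q-out , _} (there (there (here refl)) , _ , k∈) = k∈
  out-of-Q (there (there (there (here ()))) , _)
  out-of-Q (there (there (there (there (here ())))) , _)
  out-of-Q (there (there (there (there (there ())))) , _)

  into-P : ∀ {u} → Edge u (P , a₁ c) → proj₂ u ∈ a₂ c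
  into-P (here () , _)
  into-P (there (here ()) , _)
  into-P (there (there (here ())) , _)
  into-P {P-in , _} (there (there (there (here refl))) , k∈ , _) = k∈
  into-P (there (there (there (there (here ())))) , _)
  into-P (there (there (there (there (there ())))) , _)

  out-of-P : ∀ {u} → Edge (P , a₁ c) u → proj₂ u ∈ a₃ c
  out-of-P {Q , _} (here refl , _ , refl) = a∈
  out-of-P (there (here ()) , _)
  out-of-P (there (there (here ())) , _)
  out-of-P (there (there (there (here ()))) , _)
  out-of-P {P-out , _} (there (there (there (there (here refl)))) , _ , k∈) = k∈
  out-of-P (there (there (there (there (there ())))) , _)

  represents-c : Represents G ξ (enc (P , a₁ c)) c
  represents-c = ξ-enc (P , a₁ c)
               , in-image (P , a₁ c) (λ k∈ → P-in , there (there (there (here refl))) , k∈ , refl) into-P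
               , out-image (P , a₁ c)
                   (λ k∈ → P-out , there (there (there (there (here refl)))) , refl , k∈) out-of-P

  represents-a : Represents G ξ (enc (Q , a₁ a)) a
  represents-a = ξ-enc (Q , a₁ a)
               , in-image (Q , a₁ a) (λ k∈ → Q-in , there (here refl) , k∈ , refl) into-Q
               , out-image (Q , a₁ a) (λ k∈ → Q-out , there (there (here refl)) , refl , k∈) out-of-Q

  arc : EArc R c a
  arc = 6 * n , G , ξ , ξ-strictHom , enc (P , a₁ c) , enc (Q , a₁ a)
      , edge⇒arc {P , a₁ c} {Q , a₁ a} (here refl , refl , refl) , represents-c , represents-a

arc-from-labels : ∀ {n} {R : Digraph n} {c a : EV R} → a₁ c ∈ a₂ a → a₁ a ∈ a₃ c → EArc R c a
arc-from-labels {R = R} {c} {a} = Realisation.arc R c a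

⁅⁆-sound : ∀ {n} {P : Fin n → Set} {w} → P w → ∀ {u} → u ∈ ⁅ w ⁆ → P u
⁅⁆-sound {P = P} p u∈ = subst P (sym (x∈⁅y⁆⇒x≡y _ u∈)) p

∪-sound : ∀ {n} {P : Fin n → Set} {S T} → (∀ {u} → u ∈ S → P u) → (∀ {u} → u ∈ T → P u) →
          ∀ {u} → u ∈ S ∪ T → P u
∪-sound {S = S} {T} onS onT u∈ with x∈p∪q⁻ S T u∈
... | inj₁ u∈S = onS u∈S
... | inj₂ u∈T = onT u∈T

dichotomy : ∀ {n} {P Q : Fin n → Set} → (∀ w → Dec (P w)) → (∀ w → Dec (Q w)) →
            ¬ ((∃ λ w → P w × Q w) × (∃ λ w → P w × ¬ Q w)) →
            (∀ w → P w → ¬ Q w) ⊎ (∀ w → P w → Q w)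
dichotomy P? Q? ¬mixed with any? (λ w → P? w ×-dec Q? w)
... | no ¬PQ = inj₁ λ w p q → ¬PQ (w , p , q)
... | yes PQ = inj₂ λ w p → decidable-stable (Q? w) λ ¬q → ¬mixed (PQ , w , p , ¬q)

module EV-structure {n : ℕ} {R : Digraph n} where

  ≈E-sym : {a b : EV R} → a ≈E b → b ≈E a
  ≈E-sym (e₁ , e₂ , e₃) = sym e₁ , sym e₂ , sym e₃

  SameSet-unique : ∀ {S T : Subset n} {P} → SameSet S P → SameSet T P → S ≡ T
  SameSet-unique S⇔ T⇔ = ⊆-antisym (λ {z} z∈ → from (T⇔ z) (to (S⇔ z) z∈))
                                   (λ {z} z∈ → from (S⇔ z) (to (T⇔ z) z∈))

  Represents-unique : ∀ {m} {G : Digraph m} {ξ v} {a b : EV R} →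
                      Represents G ξ v a → Represents G ξ v b → a ≈E b
  Represents-unique (ξv≡a , in-a , out-a) (ξv≡b , in-b , out-b) =
    trans (sym ξv≡a) ξv≡b , SameSet-unique in-a in-b , SameSet-unique out-a out-b

  arc-labels : ∀ {c a : EV R} → EArc R c a → c ≈E a ⊎ (a₁ c ∈ a₂ a × a₁ a ∈ a₃ c)
  arc-labels {c} {a} (_ , G , ξ , _ , v , w , vw , rep-c , rep-a) with v ≟ w
  ... | yes refl = inj₁ (Represents-unique {G = G} {ξ} {v} {c} {a} rep-c rep-a)
  ... | no v≢w =
    inj₂ ( subst (_∈ a₂ a) (proj₁ rep-c) (from (proj₁ (proj₂ rep-a) (ξ v)) (v , (v≢w , vw) , refl))
         , subst (_∈ a₃ c) (proj₁ rep-a) (from (proj₂ (proj₂ rep-c) (ξ w)) (w , (≢-sym v≢w , vw) , refl)))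

  labels : Side → EV R → Subset n
  labels inward  = a₂
  labels outward = a₃

  labels-sound : ∀ s (a : EV R) {w} → w ∈ labels s a → NbOn s R (a₁ a) w
  labels-sound inward  a = a₂⊆ a _
  labels-sound outward a = a₃⊆ a _

  labels-adjacent : ∀ s (a : EV R) {w} → w ∈ labels s a → Nb R (a₁ a) w
  labels-adjacent s a w∈ = NbOn⇒Nb s (labels-sound s a w∈)

  labels-≈E : ∀ {a b : EV R} → a ≈E b → ∀ s → labels s a ≡ labels s b
  labels-≈E (_ , e₂ , _) inward  = e₂
  labels-≈E (_ , _ , e₃) outward = e₃

  nbLabels : EV R → Subset n
  nbLabels a = a₂ a ∪ a₃ a

  labels⊆nbLabels : ∀ s {a : EV R} → labels s a ⊆ nbLabels a
  labels⊆nbLabels inward  w∈ = x∈p∪q⁺ (inj₁ w∈)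
  labels⊆nbLabels outward w∈ = x∈p∪q⁺ (inj₂ w∈)

  nbLabels-side : ∀ {a : EV R} {w} → w ∈ nbLabels a → Σ Side λ s → w ∈ labels s a
  nbLabels-side {a} w∈ with x∈p∪q⁻ (a₂ a) (a₃ a) w∈
  ... | inj₁ w∈a₂ = inward , w∈a₂
  ... | inj₂ w∈a₃ = outward , w∈a₃

  nbLabels-adjacent : ∀ (a : EV R) {w} → w ∈ nbLabels a → Nb R (a₁ a) w
  nbLabels-adjacent a w∈ with nbLabels-side w∈
  ... | s , w∈s = labels-adjacent s a w∈s

  NbEOn : Side → EV R → EV R → Set
  NbEOn inward  = NinE R
  NbEOn outward = NoutE R

  neighbour⇔ : ∀ s {a c : EV R} → NbEOn s a c ⇔ (a₁ c ∈ labels s a × a₁ a ∈ labels (opposite s) c)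
  neighbour⇔ inward {a} {c} = mk⇔
    (λ { (c≉a , ca) → Data.Sum.[ (λ c≈a → ⊥-elim (c≉a c≈a)) , (λ ok → ok) ] (arc-labels {c} {a} ca) })
    (λ { (c∈ , a∈) → (λ c≈a → proj₁ (a₂⊆ a _ c∈) (proj₁ c≈a))
                   , arc-from-labels {c = c} {a} c∈ a∈ })
  neighbour⇔ outward {a} {c} = mk⇔
    (λ { (c≉a , ac) → Data.Sum.[ (λ a≈c → ⊥-elim (c≉a (≈E-sym {a} {c} a≈c))) , swap ]
                                 (arc-labels {a} {c} ac) })
    (λ { (c∈ , a∈) → (λ c≈a → proj₁ (a₃⊆ a _ c∈) (proj₁ c≈a))
                   , arc-from-labels {c = a} {c} a∈ c∈ })

  NbEOn⇒NbE : ∀ s {a c : EV R} → NbEOn s a c → NbE R a c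
  NbEOn⇒NbE inward  (c≉a , ca) = c≉a , inj₂ ca
  NbEOn⇒NbE outward (c≉a , ac) = c≉a , inj₁ ac

  NbE⇒NbEOn : ∀ {a c : EV R} → NbE R a c → Σ Side λ s → NbEOn s a c
  NbE⇒NbEOn (c≉a , inj₁ ac) = outward , c≉a , ac
  NbE⇒NbEOn (c≉a , inj₂ ca) = inward , c≉a , ca

  fromSides : (v : Fin n) (L : Side → Subset n) → (∀ s → Admissible s R v (L s)) → EV R
  fromSides v L sound = ev v (L inward) (L outward) (λ _ → sound inward) (λ _ → sound outward)

  only-sound : ∀ s {v S} → Admissible s R v S → ∀ t → Admissible t R v (only s S t)
  only-sound s sound t {w} w∈ with only⁻ s t w∈
  ... | refl , w∈S = sound {w} w∈S

  star : (s : Side) (v : Fin n) (S : Subset n) → Admissible s R v S → EV R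
  star s v S sound = fromSides v (only s S) (only-sound s sound)

  star-labels : ∀ s {v S} (sound : Admissible s R v S) {w} → w ∈ S → w ∈ labels s (star s v S sound)
  star-labels inward  _ w∈ = w∈
  star-labels outward _ w∈ = w∈

  star-labels⁻ : ∀ s t {v S} (sound : Admissible s R v S) {w} →
                 w ∈ labels t (star s v S sound) → t ≡ s × w ∈ S
  star-labels⁻ s inward  _ w∈ = only⁻ s inward w∈
  star-labels⁻ s outward _ w∈ = only⁻ s outward w∈

  star-nbLabels : ∀ s {v S} (sound : Admissible s R v S) {w} → w ∈ nbLabels (star s v S sound) → w ∈ S
  star-nbLabels s {v} {S} sound w∈ with nbLabels-side {star s v S sound} w∈
  ... | t , w∈t = proj₂ (star-labels⁻ s t sound w∈t)

  extend : (c : EV R) (s : Side) {w : Fin n} → NbOn s R (a₁ c) w → EV R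
  extend c s {w} c-w = fromSides (a₁ c) (λ t → labels t c ∪ only s ⁅ w ⁆ t)
    (λ t → ∪-sound (labels-sound t c) (only-sound s (⁅⁆-sound c-w) t))

  extend-labels : ∀ {c : EV R} {s w} {c-w : NbOn s R (a₁ c) w} t {u} →
                  u ∈ labels t c → u ∈ labels t (extend c s c-w)
  extend-labels inward  u∈ = x∈p∪q⁺ (inj₁ u∈)
  extend-labels outward u∈ = x∈p∪q⁺ (inj₁ u∈)

  extend-new : ∀ {c : EV R} s {w} {c-w : NbOn s R (a₁ c) w} → w ∈ labels s (extend c s c-w)
  extend-new inward  = x∈p∪q⁺ (inj₂ (x∈⁅x⁆ _))
  extend-new outward = x∈p∪q⁺ (inj₂ (x∈⁅x⁆ _))

  extend-neighbour : ∀ s {a c : EV R} {t w} {c-w : NbOn t R (a₁ c) w} →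
                     NbEOn s a c → NbEOn s a (extend c t c-w)
  extend-neighbour s {t = t} {w} {c-w} ac with to (neighbour⇔ s) ac
  ... | c∈ , a∈ = from (neighbour⇔ s) (c∈ , extend-labels {s = t} {w} {c-w} (opposite s) a∈)

  leaf-admissible : ∀ s (a : EV R) {d} → d ∈ labels s a → Admissible (opposite s) R d ⁅ a₁ a ⁆
  leaf-admissible s a d∈ = ⁅⁆-sound (NbOn-opposite s (labels-sound s a d∈))

  leaf : ∀ s (a : EV R) {d} → d ∈ labels s a → EV R
  leaf s a {d} d∈ = star (opposite s) d ⁅ a₁ a ⁆ (leaf-admissible s a d∈)

  leaf-neighbour : ∀ s (a : EV R) {d} (d∈ : d ∈ labels s a) → NbEOn s a (leaf s a d∈)
  leaf-neighbour s a d∈ =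
    from (neighbour⇔ s) (d∈ , star-labels (opposite s) (leaf-admissible s a d∈) (x∈⁅x⁆ (a₁ a)))

  leaf-nbLabels : ∀ s (a : EV R) {d} (d∈ : d ∈ labels s a) {w} →
                  w ∈ nbLabels (leaf s a d∈) → w ≡ a₁ a
  leaf-nbLabels s a d∈ w∈ = x∈⁅y⁆⇒x≡y _ (star-nbLabels (opposite s) (leaf-admissible s a d∈) w∈)

module Rearrangement {n : ℕ} {R : Digraph n} (X M : Subset n) (β : Fin n → Fin n) where

  open EV-structure {n} {R}

  Ψ : EV R → Fin n → Set
  Ψ = Psi R X M β

  Cond : EV R → Set
  Cond = PsiCond R X M

  PsiCond⇔ : ∀ (a : EV R) → Cond a ⇔ (a₁ a ∈ X × ∃ λ w → w ∈ nbLabels a × w ∈ M)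
  PsiCond⇔ a = mk⇔ into outof
    where
    into : Cond a → a₁ a ∈ X × ∃ λ w → w ∈ nbLabels a × w ∈ M
    into (a∈X , c , ac , c∈M) with NbE⇒NbEOn {a = a} {c = c} ac
    ... | s , ac′ = a∈X , a₁ c , labels⊆nbLabels s (proj₁ (to (neighbour⇔ s) ac′)) , c∈M
    outof : (a₁ a ∈ X × ∃ λ w → w ∈ nbLabels a × w ∈ M) → Cond a
    outof (a∈X , w , w∈ , w∈M) with nbLabels-side {a = a} w∈
    ... | s , w∈s = a∈X , leaf s a w∈s , NbEOn⇒NbE s (leaf-neighbour s a w∈s) , w∈M

  PsiCond? : ∀ a → Dec (Cond a)
  PsiCond? a = map (⇔.sym (PsiCond⇔ a)) (a₁ a ∈? X ×-dec any? λ w → w ∈? nbLabels a ×-dec w ∈? M)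

  Psi-total : ∀ a → ∃ (Ψ a)
  Psi-total a with PsiCond? a
  ... | yes p = β (a₁ a) , inj₁ (p , refl)
  ... | no ¬p = a₁ a , inj₂ (¬p , refl)

  Psi-plain : ∀ a → ¬ Cond a → Ψ a (a₁ a)
  Psi-plain a ¬p = inj₂ (¬p , refl)

  Psi-plain⁻ : ∀ {a z} → ¬ Cond a → Ψ a z → z ≡ a₁ a
  Psi-plain⁻ ¬p (inj₁ (p , _)) = ⊥-elim (¬p p)
  Psi-plain⁻ ¬p (inj₂ (_ , z≡)) = z≡

  Psi-values : ∀ {a z} → Ψ a z → z ≡ a₁ a ⊎ z ≡ β (a₁ a)
  Psi-values (inj₁ (_ , z≡)) = inj₂ z≡
  Psi-values (inj₂ (_ , z≡)) = inj₁ z≡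

  ¬Cond-outside : ∀ a → a₁ a ∉ X → ¬ Cond a
  ¬Cond-outside a a∉X p = a∉X (proj₁ p)

  ¬Cond-clear : ∀ a → (∀ {w} → w ∈ nbLabels a → w ∉ M) → ¬ Cond a
  ¬Cond-clear a clear p with to (PsiCond⇔ a) p
  ... | _ , w , w∈ , w∈M = clear w∈ w∈M

  leaf-Psi : ∀ s (a : EV R) {d} (d∈ : d ∈ labels s a) → a₁ a ∉ M → Ψ (leaf s a d∈) d
  leaf-Psi s a d∈ a∉M = Psi-plain (leaf s a d∈) (¬Cond-clear (leaf s a d∈) λ w∈ w∈M →
    a∉M (subst (_∈ M) (leaf-nbLabels s a d∈ w∈) w∈M))

  leaf-Psi-outside : ∀ s (a : EV R) {d} (d∈ : d ∈ labels s a) → d ∉ X → Ψ (leaf s a d∈) d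
  leaf-Psi-outside s a d∈ d∉X = Psi-plain (leaf s a d∈) (¬Cond-outside (leaf s a d∈) d∉X)

  PsiImgOn : Side → EV R → Fin n → Set
  PsiImgOn s a z = ∃ λ c → NbEOn s a c × Ψ c z

  EpsEq-img : ∀ {a b} → EpsEq R X M β a b → ∀ s z → PsiImgOn s a z ⇔ PsiImgOn s b z
  EpsEq-img (_ , img , _) inward  = img
  EpsEq-img (_ , _ , img) outward = img

  EpsEq-sym : ∀ {a b} → EpsEq R X M β a b → EpsEq R X M β b a
  EpsEq-sym (ψ , img-in , img-out) =
    (λ z → ⇔.sym (ψ z)) , (λ z → ⇔.sym (img-in z)) , (λ z → ⇔.sym (img-out z))

  module Sufficiency {Y : Subset n}
    (X∩M≡∅ : Disjoint X M) (M∩Y≡∅ : Disjoint M Y)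
    (Y-avoids-M : (y : Fin n) → y ∈ Y → (w : Fin n) → Nb R y w → w ∉ M)
    (bij : BijectiveOn β X Y) where

    β∈Y : ∀ {x} → x ∈ X → β x ∈ Y
    β∈Y = proj₁ bij _

    β-injective : ∀ {x x′} → x ∈ X → x′ ∈ X → β x ≡ β x′ → x ≡ x′
    β-injective = proj₁ (proj₂ bij) _ _

    -- ψ fixes the M-label w of a neighbour of a (w ∉ X), so ε(b) would have to show w as the ψ-value
    -- of a neighbour of a₁ b = β(a₁ a) ∈ Y; but M avoids Y and the neighbours of Y.
    mixed-values-impossible : ∀ {a b} → EpsEq R X M β a b → Cond a → ¬ Cond b → β (a₁ a) ≢ a₁ b
    mixed-values-impossible {a} {b} ε pa ¬pb βa≡b with to (PsiCond⇔ a) pa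
    ... | a∈X , w , w∈ , w∈M with nbLabels-side {a = a} w∈
    ... | s , w∈s with to (EpsEq-img ε s w) (leaf s a w∈s , leaf-neighbour s a w∈s ,
                                             leaf-Psi-outside s a w∈s λ w∈X → X∩M≡∅ w w∈X w∈M)
    ... | c , bc , inj₁ (pc , w≡) = M∩Y≡∅ w w∈M (subst (_∈ Y) (sym w≡) (β∈Y (proj₁ pc)))
    ... | c , bc , inj₂ (_ , w≡) =
      Y-avoids-M (a₁ b) (subst (_∈ Y) βa≡b (β∈Y a∈X)) w
        (subst (Nb R (a₁ b)) (sym w≡) (labels-adjacent s b (proj₁ (to (neighbour⇔ s) bc)))) w∈M

    label-eq : ∀ {a b} → EpsEq R X M β a b → a₁ a ≡ a₁ b
    label-eq {a} {b} ε with Psi-total a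
    ... | z , ψa with ψa | to (proj₁ ε z) ψa
    ... | inj₁ (pa , za) | inj₁ (pb , zb) = β-injective (proj₁ pa) (proj₁ pb) (trans (sym za) zb)
    ... | inj₂ (_ , za)  | inj₂ (_ , zb)  = trans (sym za) zb
    ... | inj₁ (pa , za) | inj₂ (¬pb , zb) =
      ⊥-elim (mixed-values-impossible {a} {b} ε pa ¬pb (trans (sym za) zb))
    ... | inj₂ (¬pa , za) | inj₁ (pb , zb) =
      ⊥-elim (mixed-values-impossible {b} {a} (EpsEq-sym {a} {b} ε) pb ¬pa (trans (sym zb) za))

    mixed-neighbours-impossible : NbCondition R X M → ∀ {c v} → Cond c →
                                  Nb R (a₁ c) v → Nb R (β (a₁ c)) v → ⊥
    mixed-neighbours-impossible cond {c} {v} pc cv βcv with to (PsiCond⇔ c) pc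
    ... | c∈X , w , w∈ , w∈M with cond (a₁ c) c∈X
    ... | inj₁ none-in-M = none-in-M w (nbLabels-adjacent c w∈) w∈M
    ... | inj₂ all-in-M = Y-avoids-M (β (a₁ c)) (β∈Y c∈X) v βcv (all-in-M v cv)

    label-determined : NbCondition R X M → ∀ {c c′ v z} → Nb R (a₁ c) v → Nb R (a₁ c′) v →
                       Ψ c z → Ψ c′ z → a₁ c ≡ a₁ c′
    label-determined cond _ _ (inj₁ (pc , zc)) (inj₁ (pc′ , zc′)) =
      β-injective (proj₁ pc) (proj₁ pc′) (trans (sym zc) zc′)
    label-determined cond _ _ (inj₂ (_ , zc)) (inj₂ (_ , zc′)) = trans (sym zc) zc′
    label-determined cond {c} {c′} cv c′v (inj₁ (pc , zc)) (inj₂ (_ , zc′)) =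
      ⊥-elim (mixed-neighbours-impossible cond {c} pc cv
                (subst (λ y → Nb R y _) (trans (sym zc′) zc) c′v))
    label-determined cond {c} {c′} cv c′v (inj₂ (_ , zc)) (inj₁ (pc′ , zc′)) =
      ⊥-elim (mixed-neighbours-impossible cond {c′} pc′ c′v
                (subst (λ y → Nb R y _) (trans (sym zc) zc′) cv))

    labels-⊆ : NbCondition R X M → ∀ {a b} → EpsEq R X M β a b → ∀ s → labels s a ⊆ labels s b
    labels-⊆ cond {a} {b} ε s {d} d∈ with Psi-total (leaf s a d∈)
    ... | z , ψd with to (EpsEq-img ε s z) (leaf s a d∈ , leaf-neighbour s a d∈ , ψd)
    ... | c , bc , ψc = subst (_∈ labels s b) (sym d≡c) c∈
      where
      c∈ : a₁ c ∈ labels s b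
      c∈ = proj₁ (to (neighbour⇔ s) bc)
      d≡c : d ≡ a₁ c
      d≡c = label-determined cond {leaf s a d∈} {c} (Nb-sym {R = R} (labels-adjacent s a d∈))
              (subst (Nb R (a₁ c)) (sym (label-eq {a} {b} ε)) (Nb-sym {R = R} (labels-adjacent s b c∈))) ψd ψc

    ε-injective : NbCondition R X M → EpsInjective R X M β
    ε-injective cond a b ε =
      label-eq {a} {b} ε ,
      ⊆-antisym (labels-⊆ cond {a} {b} ε inward) (labels-⊆ cond {b} {a} ε′ inward) ,
      ⊆-antisym (labels-⊆ cond {a} {b} ε outward) (labels-⊆ cond {b} {a} ε′ outward)
      where ε′ = EpsEq-sym {a} {b} ε

  module Necessity {Y : Subset n}
    (X∩M≡∅ : Disjoint X M) (M∩Y≡∅ : Disjoint M Y) (X∩Y≡∅ : Disjoint X Y)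
    (β∈Y : ∀ {x} → x ∈ X → β x ∈ Y)
    (transfer : ∀ s {x w} → x ∈ X → NbOn s R x w → w ∉ M → NbOn s R (β x) w)
    (ε-inj : EpsInjective R X M β) where

    module Witnesses {x w₁ w₂ : Fin n} (x∈X : x ∈ X) (x-w₁ : Nb R x w₁) (w₁∈M : w₁ ∈ M)
                     (x-w₂ : Nb R x w₂) (w₂∉M : w₂ ∉ M) where

      s t : Side
      s = proj₁ (Nb⇒NbOn {R = R} x-w₂)
      t = opposite s

      w₂-x : NbOn t R w₂ x
      w₂-x = NbOn-opposite s (proj₂ (Nb⇒NbOn {R = R} x-w₂))

      w₂-βx : NbOn t R w₂ (β x)
      w₂-βx = NbOn-opposite s (transfer s x∈X (proj₂ (Nb⇒NbOn {R = R} x-w₂)) w₂∉M)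

      βx∉X : β x ∉ X
      βx∉X βx∈X = X∩Y≡∅ (β x) βx∈X (β∈Y x∈X)

      Pair : Subset n
      Pair = ⁅ x ⁆ ∪ ⁅ β x ⁆

      Pair-avoids-M : ∀ {w} → w ∈ Pair → w ∉ M
      Pair-avoids-M = ∪-sound {P = _∉ M} (⁅⁆-sound (X∩M≡∅ x x∈X))
                                         (⁅⁆-sound λ βx∈M → M∩Y≡∅ (β x) βx∈M (β∈Y x∈X))

      a-admissible : Admissible t R w₂ ⁅ x ⁆
      a-admissible = ⁅⁆-sound w₂-x

      b-admissible : Admissible t R w₂ Pair
      b-admissible = ∪-sound (⁅⁆-sound w₂-x) (⁅⁆-sound w₂-βx)

      a b : EV R
      a = star t w₂ ⁅ x ⁆ a-admissible
      b = star t w₂ Pair b-admissible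

      x∈a : x ∈ labels t a
      x∈a = star-labels t {w₂} {⁅ x ⁆} a-admissible (x∈⁅x⁆ x)

      x∈b : x ∈ labels t b
      x∈b = star-labels t {w₂} {Pair} b-admissible (x∈p∪q⁺ (inj₁ (x∈⁅x⁆ x)))

      βx∈b : β x ∈ labels t b
      βx∈b = star-labels t {w₂} {Pair} b-admissible (x∈p∪q⁺ (inj₂ (x∈⁅x⁆ (β x))))

      ¬Cond-a : ¬ Cond a
      ¬Cond-a = ¬Cond-clear a λ w∈ →
        Pair-avoids-M (x∈p∪q⁺ (inj₁ (star-nbLabels t {w₂} {⁅ x ⁆} a-admissible w∈)))

      ¬Cond-b : ¬ Cond b
      ¬Cond-b = ¬Cond-clear b λ w∈ → Pair-avoids-M (star-nbLabels t {w₂} {Pair} b-admissible w∈)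

      a-neighbour : ∀ {u c} → NbEOn u a c → u ≡ t × a₁ c ∈ ⁅ x ⁆
      a-neighbour {u} {c} ac = star-labels⁻ t u {w₂} {⁅ x ⁆} a-admissible (proj₁ (to (neighbour⇔ u {a} {c}) ac))

      b-neighbour : ∀ {u c} → NbEOn u b c → u ≡ t × a₁ c ∈ Pair
      b-neighbour {u} {c} bc = star-labels⁻ t u {w₂} {Pair} b-admissible (proj₁ (to (neighbour⇔ u {b} {c}) bc))

      x-values : ∀ {c z} → a₁ c ∈ ⁅ x ⁆ → Ψ c z → z ≡ x ⊎ z ≡ β x
      x-values {c} {z} c∈ ψc = subst (λ y → z ≡ y ⊎ z ≡ β y) (x∈⁅y⁆⇒x≡y x c∈) (Psi-values {c} ψc)

      image-a : ∀ {u z} → PsiImgOn u a z → u ≡ t × (z ≡ x ⊎ z ≡ β x)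
      image-a (c , ac , ψc) with a-neighbour {c = c} ac
      ... | u≡t , c∈ = u≡t , x-values {c} c∈ ψc

      image-b : ∀ {u z} → PsiImgOn u b z → u ≡ t × (z ≡ x ⊎ z ≡ β x)
      image-b (c , bc , ψc) with b-neighbour {c = c} bc
      ... | u≡t , c∈ with x∈p∪q⁻ ⁅ x ⁆ ⁅ β x ⁆ c∈
      ...   | inj₁ c∈x = u≡t , x-values {c} c∈x ψc
      ...   | inj₂ c∈βx = u≡t , inj₂ (trans (Psi-plain⁻ {c} (¬Cond-outside c c∉X) ψc) c≡βx)
        where
        c≡βx = x∈⁅y⁆⇒x≡y (β x) c∈βx
        c∉X = subst (_∉ X) (sym c≡βx) βx∉X

      realise-a : ∀ {z} → z ≡ x ⊎ z ≡ β x → PsiImgOn t a z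
      realise-a (inj₁ refl) = leaf t a x∈a , leaf-neighbour t a x∈a , leaf-Psi t a x∈a w₂∉M
      realise-a (inj₂ refl) =
        c , extend-neighbour t {a} {leaf t a x∈a} {s₁} {w₁} {x-w₁′} (leaf-neighbour t a x∈a)
          , inj₁ (Cond-c , refl)
        where
        s₁ : Side
        s₁ = proj₁ (Nb⇒NbOn {R = R} x-w₁)
        x-w₁′ : NbOn s₁ R x w₁
        x-w₁′ = proj₂ (Nb⇒NbOn {R = R} x-w₁)
        c : EV R
        c = extend (leaf t a x∈a) s₁ x-w₁′
        Cond-c : Cond c
        Cond-c = from (PsiCond⇔ c)
          (x∈X , w₁ , labels⊆nbLabels s₁ {c} (extend-new {leaf t a x∈a} s₁ {w₁} {x-w₁′}) , w₁∈M)

      realise-b : ∀ {z} → z ≡ x ⊎ z ≡ β x → PsiImgOn t b z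
      realise-b (inj₁ refl) = leaf t b x∈b , leaf-neighbour t b x∈b , leaf-Psi t b x∈b w₂∉M
      realise-b (inj₂ refl) = leaf t b βx∈b , leaf-neighbour t b βx∈b , leaf-Psi-outside t b βx∈b βx∉X

      same-image : ∀ u z → PsiImgOn u a z ⇔ PsiImgOn u b z
      same-image u z = mk⇔
        (λ i → let u≡t , p = image-a {u} {z} i in subst (λ u → PsiImgOn u b z) (sym u≡t) (realise-b p))
        (λ i → let u≡t , p = image-b {u} {z} i in subst (λ u → PsiImgOn u a z) (sym u≡t) (realise-a p))

      same-value : ∀ z → Ψ a z ⇔ Ψ b z
      same-value z = mk⇔
        (λ ψa → subst (Ψ b) (sym (Psi-plain⁻ {a} ¬Cond-a ψa)) (Psi-plain b ¬Cond-b))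
        (λ ψb → subst (Ψ a) (sym (Psi-plain⁻ {b} ¬Cond-b ψb)) (Psi-plain a ¬Cond-a))

      contradiction : ⊥
      contradiction = X∩Y≡∅ x x∈X (subst (_∈ Y) βx≡x (β∈Y x∈X))
        where
        βx∈a : β x ∈ labels t a
        a≈b : a ≈E b
        a≈b = ε-inj a b (same-value , same-image inward , same-image outward)
        βx∈a = subst (β x ∈_) (sym (labels-≈E a≈b t)) βx∈b
        βx≡x : β x ≡ x
        βx≡x = x∈⁅y⁆⇒x≡y x (proj₂ (star-labels⁻ t t {w₂} {⁅ x ⁆} a-admissible βx∈a))

    NbCondition-necessary : NbCondition R X M
    NbCondition-necessary x x∈X = dichotomy (Nb? R x) (_∈? M)
      λ { ((w₁ , x-w₁ , w₁∈M) , (w₂ , x-w₂ , w₂∉M)) →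
            Witnesses.contradiction x∈X x-w₁ w₁∈M x-w₂ w₂∉M }

lemma7 : ∀ {n : ℕ} (R : Digraph n) (X M Y : Subset n) (β : Fin n → Fin n) →
    Disjoint X M →
    Disjoint M Y →
    ((y : Fin n) → y ∈ Y → (w : Fin n) → Nb R y w → w ∉ M) →
    BijectiveOn β X Y →
    HomOn R β X →
    ((x : Fin n) → x ∈ X → (w : Fin n) → Nin R x w → w ∉ M → Nin R (β x) w) →
    ((x : Fin n) → x ∈ X → (w : Fin n) → Nout R x w → w ∉ M → Nout R (β x) w) →
    (NbCondition R X M → EpsInjective R X M β) ×
    (Disjoint X Y → EpsInjective R X M β → NbCondition R X M)
lemma7 R X M Y β X∩M≡∅ M∩Y≡∅ Y-avoids-M bij _ hin hout =
  Sufficiency.ε-injective {Y = Y} X∩M≡∅ M∩Y≡∅ Y-avoids-M bij ,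
  λ X∩Y≡∅ ε-inj →
    Necessity.NbCondition-necessary {Y = Y} X∩M≡∅ M∩Y≡∅ X∩Y≡∅ (proj₁ bij _) transfer ε-inj
  where
  open Rearrangement {R = R} X M β
  transfer : ∀ s {x w} → x ∈ X → NbOn s R x w → w ∉ M → NbOn s R (β x) w
  transfer inward  x∈X = hin _ x∈X _
  transfer outward x∈X = hout _ x∈X _
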